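{- Let $G$ be a bipartite graph with partite sets $A$ and $B$, and let $M$ be a maximum matching in $G$ such that $D(M)$ is acyclic and the induced subgraphs $G[V^+(M)]$ and $G[V^-(M)]$ are forests. If $M'$ arises from $M$ by an edge exchange, then $D(M')$ is acyclic.
   Context: Graphs are finite and simple. For a bipartite graph $G$ with (fixed) partite sets $A$, $B$ and a matching $M$, let $D(M)$ be the digraph with vertex set $V(G)$ and arcs $(a,b)$ for $a\in A$, $b\in B$, $ab\in E(G)\setminus M$, and $(b,a)$ for $a\in A$, $b\in B$, $ab\in M$. Let $A_0(M)$ be the set of vertices of $A$ not covered by $M$ and $B_0(M)$ the set of vertices of $B$ not covered by $M$. Let $V^+(M)$ be the set of vertices $v$ such that $D(M)$ contains a directed path (possibly of length zero) from some vertex of $A_0(M)$ to $v$, and $V^-(M)$ the set of vertices $w$ such that $D(M)$ contains a directed path (possibly of length zero) from $w$ to some vertex of $B_0(M)$. Edge exchange: if $M$ is a maximum matching, $a\in A_0(M)$, and $a'b'\in M$ ($a'\in A$, $b'\in B$) with $b'$ adjacent to $a$, then $(M\setminus\{a'b'\})\cup\{ab'\}$ arises from $M$ by an edge exchange; similarly, if $b\in B_0(M)$ and $a'b'\in M$ with $a'$ adjacent to $b$, then $(M\setminus\{a'b'\})\cup\{a'b\}$ arises from $M$ by an edge exchange. -}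

module Defs where

open import Data.Nat using (ℕ; zero; suc; _+_; _≤_)
open import Data.Fin using (Fin; zero; suc; inject₁; fromℕ; _≟_)
open import Data.Bool using (Bool; true; false; if_then_else_; _∧_)
open import Data.Sum using (_⊎_; inj₁; inj₂)
open import Data.Product using (Σ; _×_; _,_; ∃)
open import Data.Empty using (⊥)
open import Data.List using (List; map; allFin; concatMap)
open import Data.Nat.ListAction using (sum)
open import Relation.Nullary using (¬_)
open import Relation.Nullary.Decidable using (⌊_⌋)
open import Relation.Binary.PropositionalEquality using (_≡_)
open import Relation.Binary.Construct.Closure.ReflexiveTransitive using (Star)
open import Relation.Binary.Construct.Closure.Transitive using (TransClosure)
open import Function.Definitions using (Injective)

-- A bipartite graph with partite sets A = Fin p and B = Fin q,
-- given by its (decidable) edge relation between A and B.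
BipGraph : ℕ → ℕ → Set
BipGraph p q = Fin p → Fin q → Bool

EdgeSet : ℕ → ℕ → Set
EdgeSet p q = Fin p → Fin q → Bool

Vtx : ℕ → ℕ → Set
Vtx p q = Fin p ⊎ Fin q

module _ {p q : ℕ} (G : BipGraph p q) where

  IsMatching : EdgeSet p q → Set
  IsMatching N =
    (∀ a b → N a b ≡ true → G a b ≡ true)
    × (∀ a b b' → N a b ≡ true → N a b' ≡ true → b ≡ b')
    × (∀ a a' b → N a b ≡ true → N a' b ≡ true → a ≡ a')

  size : EdgeSet p q → ℕ
  size N = sum (concatMap (λ a → map (λ b → if N a b then 1 else 0) (allFin q)) (allFin p))

  IsMaximumMatching : EdgeSet p q → Set
  IsMaximumMatching M = IsMatching M × (∀ N → IsMatching N → size N ≤ size M)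

  -- arcs of D(M): a → b for non-matching edges, b → a for matching edges
  Arc : EdgeSet p q → Vtx p q → Vtx p q → Set
  Arc M (inj₁ a) (inj₂ b) = (G a b ≡ true) × (M a b ≡ false)
  Arc M (inj₂ b) (inj₁ a) = M a b ≡ true
  Arc M (inj₁ _) (inj₁ _) = ⊥
  Arc M (inj₂ _) (inj₂ _) = ⊥

  Acyclic : EdgeSet p q → Set
  Acyclic M = ∀ v → ¬ TransClosure (Arc M) v v

  A₀ : EdgeSet p q → Fin p → Set
  A₀ M a = ∀ b → M a b ≡ false

  B₀ : EdgeSet p q → Fin q → Set
  B₀ M b = ∀ a → M a b ≡ false

  V⁺ : EdgeSet p q → Vtx p q → Set
  V⁺ M v = Σ (Fin p) λ a → A₀ M a × Star (Arc M) (inj₁ a) v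

  V⁻ : EdgeSet p q → Vtx p q → Set
  V⁻ M w = Σ (Fin q) λ b → B₀ M b × Star (Arc M) w (inj₂ b)

  Adj : Vtx p q → Vtx p q → Set
  Adj (inj₁ a) (inj₂ b) = G a b ≡ true
  Adj (inj₂ b) (inj₁ a) = G a b ≡ true
  Adj (inj₁ _) (inj₁ _) = ⊥
  Adj (inj₂ _) (inj₂ _) = ⊥

  -- a cycle of G[S]: distinct vertices f 0, …, f (k+2) (length k+3 ≥ 3),
  -- all in S, consecutive ones adjacent, and the last adjacent to the first
  IsCycleIn : (Vtx p q → Set) → (k : ℕ) → (Fin (suc (suc (suc k))) → Vtx p q) → Set
  IsCycleIn S k f =
    Injective _≡_ _≡_ f
    × (∀ i → S (f i))
    × (∀ (i : Fin (suc (suc k))) → Adj (f (inject₁ i)) (f (suc i)))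
    × Adj (f (fromℕ (suc (suc k)))) (f zero)

  InducedForest : (Vtx p q → Set) → Set
  InducedForest S = ∀ k f → ¬ IsCycleIn S k f

  exchangeA : EdgeSet p q → Fin p → Fin p → Fin q → EdgeSet p q
  exchangeA M a a' b' x y =
    if ⌊ x ≟ a ⌋ ∧ ⌊ y ≟ b' ⌋ then true
    else if ⌊ x ≟ a' ⌋ ∧ ⌊ y ≟ b' ⌋ then false
    else M x y

  exchangeB : EdgeSet p q → Fin q → Fin p → Fin q → EdgeSet p q
  exchangeB M b a' b' x y =
    if ⌊ x ≟ a' ⌋ ∧ ⌊ y ≟ b ⌋ then true
    else if ⌊ x ≟ a' ⌋ ∧ ⌊ y ≟ b' ⌋ then false
    else M x y

  EdgeExchange : EdgeSet p q → EdgeSet p q → Set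
  EdgeExchange M M' =
    IsMaximumMatching M ×
    ( (Σ (Fin p) λ a → Σ (Fin p) λ a' → Σ (Fin q) λ b' →
         A₀ M a × M a' b' ≡ true × G a b' ≡ true
         × (∀ x y → M' x y ≡ exchangeA M a a' b' x y))
    ⊎ (Σ (Fin q) λ b → Σ (Fin p) λ a' → Σ (Fin q) λ b' →
         B₀ M b × M a' b' ≡ true × G a' b ≡ true
         × (∀ x y → M' x y ≡ exchangeB M b a' b' x y)))

module Submission where

-- In both kinds of edge exchange M' arises from M by adding a
-- matching edge a₁b₁ and deleting a matching edge a₀b₀ (case A: a₁b₁ = ab',
-- a₀b₀ = a'b'; case B: a₁b₁ = a'b, a₀b₀ = a'b').  Hence every arc of D(M') is
-- an arc of D(M), the new arc b₁ → a₁, or the arc a₀ → b₀.  The last one lies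
-- on no directed cycle: a₀ is uncovered by M' in case A (so it has no in-arc)
-- and b₀ is uncovered by M' in case B (so it has no out-arc).  A directed cycle
-- of D(M') is therefore a cycle of D(M), which is impossible, or it passes
-- through b₁ → a₁; cutting it at the last such passage leaves a walk a₁ ⇝ b₁
-- whose arcs lie in both D(M) and D(M').  This walk has at least two arcs,
-- its vertices are distinct because D(M) is acyclic, and they all lie in
-- V⁺(M) (case A: a₁ ∈ A₀(M)) resp. V⁻(M) (case B: b₁ ∈ B₀(M)).  Together with
-- the edge a₁b₁ it forms a cycle of the induced forest: a contradiction.

open import Defs
open import Data.Nat using (ℕ; zero; suc)
open import Data.Fin using (Fin; zero; suc; inject₁; fromℕ; _≟_)
open import Data.Bool using (true; false; if_then_else_; _∧_)
open import Data.Bool.Properties using (¬-not)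
open import Function using (case_of_)
open import Data.Sum using (_⊎_; inj₁; inj₂)
open import Data.Product using (Σ; _×_; _,_; proj₁; proj₂)
open import Data.Empty using (⊥-elim)
open import Relation.Nullary using (¬_; yes; no; contradiction)
open import Relation.Nullary.Decidable using (⌊_⌋)
open import Relation.Binary.PropositionalEquality using (_≡_; _≢_; refl; sym; trans; cong; subst)
open import Relation.Binary.Construct.Intersection using (_∩_)
open import Relation.Binary.Construct.Closure.ReflexiveTransitive using (Star; ε; _◅_; _◅◅_; map)
open import Relation.Binary.Construct.Closure.Transitive using (TransClosure; [_]; _∷_)

IsAcyclic : {V : Set} → (V → V → Set) → Set
IsAcyclic {V} S = ∀ (v : V) → ¬ TransClosure S v v

module _ {V : Set} {S : V → V → Set} where

  plus⇒star : ∀ {x y} → TransClosure S x y → Star S x y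
  plus⇒star [ e ]    = e ◅ ε
  plus⇒star (e ∷ es) = e ◅ plus⇒star es

  _◅⁺_ : ∀ {x y z} → S x y → Star S y z → TransClosure S x z
  e ◅⁺ ε        = [ e ]
  e ◅⁺ (e' ◅ w) = e ∷ (e' ◅⁺ w)

  plus-map : ∀ {T : V → V → Set} → (∀ {u v} → S u v → T u v)
           → ∀ {x y} → TransClosure S x y → TransClosure T x y
  plus-map f [ e ]    = [ f e ]
  plus-map f (e ∷ es) = f e ∷ plus-map f es

  length : ∀ {x y} → Star S x y → ℕ
  length ε       = zero
  length (_ ◅ w) = suc (length w)

  vertex : ∀ {x y} (w : Star S x y) → Fin (suc (length w)) → V
  vertex {x} w       zero    = x
  vertex     (_ ◅ w) (suc i) = vertex w i

  vertex-last : ∀ {x y} (w : Star S x y) → vertex w (fromℕ (length w)) ≡ y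
  vertex-last ε       = refl
  vertex-last (_ ◅ w) = vertex-last w

  vertex-arc : ∀ {x y} (w : Star S x y) (i : Fin (length w))
             → S (vertex w (inject₁ i)) (vertex w (suc i))
  vertex-arc (e ◅ _) zero    = e
  vertex-arc (_ ◅ w) (suc i) = vertex-arc w i

  vertex-from : ∀ {x y} (w : Star S x y) i → Star S x (vertex w i)
  vertex-from w       zero    = ε
  vertex-from (e ◅ w) (suc i) = e ◅ vertex-from w i

  vertex-to : ∀ {x y} (w : Star S x y) i → Star S (vertex w i) y
  vertex-to w       zero    = w
  vertex-to (_ ◅ w) (suc i) = vertex-to w i

  vertex-injective : IsAcyclic S → ∀ {x y} (w : Star S x y) i j
                   → vertex w i ≡ vertex w j → i ≡ j
  vertex-injective ac w       zero    zero    _  = refl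
  vertex-injective ac (e ◅ w) zero    (suc j) eq =
    ⊥-elim (ac _ (subst (λ z → TransClosure S z (vertex w j)) eq
                        (e ◅⁺ vertex-from w j)))
  vertex-injective ac (e ◅ w) (suc i) zero    eq =
    ⊥-elim (ac _ (subst (λ z → TransClosure S z (vertex w i)) (sym eq)
                        (e ◅⁺ vertex-from w i)))
  vertex-injective ac (_ ◅ w) (suc i) (suc j) eq = cong suc (vertex-injective ac w i j eq)

-- S is an acyclic "old" relation and R a "new" one such that
-- every R-arc which can occur on a closed R-walk (its tail has an in-arc and
-- its head an out-arc) is an S-arc or the single extra arc s → t.  Then every
-- closed R-walk yields a walk t ⇝ s using arcs of both R and S.
module Reroute {V : Set} (S R : V → V → Set) (s t : V) where

  HasIn : V → Set
  HasIn u = Σ V λ w → R w u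

  HasOut : V → Set
  HasOut v = Σ V λ w → R v w

  ArcsOnCycles : Set
  ArcsOnCycles = ∀ {u v} → R u v → HasIn u → HasOut v → S u v ⊎ (u ≡ s × v ≡ t)

  first-out : ∀ {x y} → TransClosure R x y → HasOut x
  first-out [ r ]   = _ , r
  first-out (r ∷ _) = _ , r

  last-in : ∀ {x y} → TransClosure R x y → HasIn y
  last-in [ r ]    = _ , r
  last-in (_ ∷ rs) = last-in rs

  reroute : ArcsOnCycles → ∀ {x y} → HasIn x → HasOut y → TransClosure R x y
          → TransClosure (R ∩ S) x y ⊎ (Star (R ∩ S) x s × Star (R ∩ S) t y)
  reroute on-cycles hi ho [ r ] with on-cycles r hi ho
  ... | inj₁ old           = inj₁ [ r , old ]
  ... | inj₂ (refl , refl) = inj₂ (ε , ε)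
  reroute on-cycles hi ho (r ∷ rs)
    with on-cycles r hi (first-out rs) | reroute on-cycles (_ , r) ho rs
  ... | inj₁ old           | inj₁ common           = inj₁ ((r , old) ∷ common)
  ... | inj₁ old           | inj₂ (before , after) = inj₂ ((r , old) ◅ before , after)
  ... | inj₂ (refl , refl) | inj₁ common           = inj₂ (ε , plus⇒star common)
  ... | inj₂ (refl , refl) | inj₂ (_ , after)      = inj₂ (ε , after)

  -- A closed R-walk at v gives t ⇝ v ⇝ s, since a closed walk of common arcs
  -- would be a cycle of S.
  detour : ArcsOnCycles → IsAcyclic S → ∀ v → TransClosure R v v → Star (R ∩ S) t s
  detour on-cycles ac v c with reroute on-cycles (last-in c) (first-out c) c
  ... | inj₁ common      = ⊥-elim (ac v (plus-map proj₂ common))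
  ... | inj₂ (v⇝s , t⇝v) = t⇝v ◅◅ v⇝s

pair-true : ∀ {p q} {x a : Fin p} {y b : Fin q}
          → ⌊ x ≟ a ⌋ ∧ ⌊ y ≟ b ⌋ ≡ true → x ≡ a × y ≡ b
pair-true {x = x} {a} {y} {b} with x ≟ a | y ≟ b
... | yes x≡a | yes y≡b = λ _ → x≡a , y≡b
... | yes _   | no _    = λ ()
... | no _    | _       = λ ()

pair-refl : ∀ {p q} (a : Fin p) (b : Fin q) → ⌊ a ≟ a ⌋ ∧ ⌊ b ≟ b ⌋ ≡ true
pair-refl a b with a ≟ a | b ≟ b
... | yes _  | yes _  = refl
... | yes _  | no b≢b = contradiction refl b≢b
... | no a≢a | _      = contradiction refl a≢a

-- N with the edge a₁b₁ added and the edge a₀b₀ deleted.  Both edge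
-- exchanges are of this form: exchangeA M a a' b' = replace M a b' a' b' and
-- exchangeB M b a' b' = replace M a' b a' b'.
replace : ∀ {p q} → EdgeSet p q → Fin p → Fin q → Fin p → Fin q → EdgeSet p q
replace N a₁ b₁ a₀ b₀ x y =
  if ⌊ x ≟ a₁ ⌋ ∧ ⌊ y ≟ b₁ ⌋ then true
  else if ⌊ x ≟ a₀ ⌋ ∧ ⌊ y ≟ b₀ ⌋ then false
  else N x y

module _ {p q : ℕ} (G : BipGraph p q) where

  walk-cycle : {S : Vtx p q → Vtx p q → Set} (P : Vtx p q → Set)
    → IsAcyclic S → (∀ {u v} → S u v → Adj G u v)
    → ∀ {x y z w} → (∀ v → Star S x v → Star S v w → P v)
    → (e₁ : S x y) (e₂ : S y z) (rest : Star S z w) → Adj G w x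
    → IsCycleIn G P (length rest) (vertex (e₁ ◅ e₂ ◅ rest))
  walk-cycle {S} P ac edge {x} {w = w} inP e₁ e₂ rest closing =
      (λ {i} {j} → vertex-injective ac walk i j)
    , (λ i → inP (vertex walk i) (vertex-from walk i) (vertex-to walk i))
    , (λ i → edge (vertex-arc walk i))
    , subst (λ v → Adj G v _) (sym (vertex-last walk)) closing
    where
    walk : Star S x w
    walk = e₁ ◅ e₂ ◅ rest

  acyclic-by-rerouting : (S R : Vtx p q → Vtx p q → Set) (s t : Vtx p q)
    → (P : Vtx p q → Set)
    → IsAcyclic S → (∀ {u v} → S u v → Adj G u v)
    → Reroute.ArcsOnCycles S R s t → t ≢ s → ¬ R t s
    → (∀ v → Star S t v → Star S v s → P v) → Adj G s t
    → InducedForest G P → IsAcyclic R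
  acyclic-by-rerouting S R s t P ac edge on-cycles t≢s ¬ts inP closing forest v c
    with Reroute.detour S R s t on-cycles ac v c
  ... | ε              = t≢s refl
  ... | e ◅ ε          = ¬ts (proj₁ e)
  ... | e₁ ◅ e₂ ◅ rest =
    forest _ _ (walk-cycle P ac edge inP (proj₂ e₁) (proj₂ e₂) (map proj₂ rest) closing)

  arc⇒adj : ∀ {M} → IsMatching G M → ∀ {u v} → Arc G M u v → Adj G u v
  arc⇒adj _         {inj₁ _} {inj₂ _} (edge , _) = edge
  arc⇒adj (inG , _) {inj₂ b} {inj₁ a} m          = inG a b m

  A₀-unmatched : ∀ N {a b} → A₀ G N a → ¬ N a b ≡ true
  A₀-unmatched N a∉N m = contradiction (trans (sym m) (a∉N _)) λ ()

  B₀-unmatched : ∀ N {a b} → B₀ G N b → ¬ N a b ≡ true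
  B₀-unmatched N b∉N m = contradiction (trans (sym m) (b∉N _)) λ ()

  A₀-no-in : ∀ N {a} → A₀ G N a → ∀ w → ¬ Arc G N w (inj₁ a)
  A₀-no-in N a∉N (inj₂ b) = A₀-unmatched N a∉N

  B₀-no-out : ∀ N {b} → B₀ G N b → ∀ w → ¬ Arc G N (inj₂ b) w
  B₀-no-out N b∉N (inj₁ a) = B₀-unmatched N b∉N

  module _ {M M' : EdgeSet p q} {a₁ a₀ : Fin p} {b₁ b₀ : Fin q}
           (M'≡ : ∀ x y → M' x y ≡ replace M a₁ b₁ a₀ b₀ x y) where

    added-edge : M' a₁ b₁ ≡ true
    added-edge rewrite M'≡ a₁ b₁ | pair-refl a₁ b₁ = refl

    edge-of-M' : ∀ x y → M' x y ≡ true
               → (x ≡ a₁ × y ≡ b₁) ⊎ (M x y ≡ true × ¬ (x ≡ a₀ × y ≡ b₀))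
    edge-of-M' x y e rewrite M'≡ x y
      with ⌊ x ≟ a₁ ⌋ ∧ ⌊ y ≟ b₁ ⌋ in added | ⌊ x ≟ a₀ ⌋ ∧ ⌊ y ≟ b₀ ⌋ in deleted
    ... | true  | _     = inj₁ (pair-true added)
    ... | false | false = inj₂ (e , λ { (refl , refl) → not-deleted deleted })
      where
      not-deleted : ¬ ⌊ a₀ ≟ a₀ ⌋ ∧ ⌊ b₀ ≟ b₀ ⌋ ≡ false
      not-deleted d = contradiction (trans (sym d) (pair-refl a₀ b₀)) λ ()

    non-edge-of-M' : ∀ x y → M' x y ≡ false → (x ≡ a₀ × y ≡ b₀) ⊎ M x y ≡ false
    non-edge-of-M' x y e rewrite M'≡ x y
      with ⌊ x ≟ a₁ ⌋ ∧ ⌊ y ≟ b₁ ⌋ | ⌊ x ≟ a₀ ⌋ ∧ ⌊ y ≟ b₀ ⌋ in deleted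
    ... | false | true  = inj₁ (pair-true deleted)
    ... | false | false = inj₂ e

    replaced-arc : ∀ {u v} → Arc G M' u v
      → Arc G M u v ⊎ ((u ≡ inj₂ b₁ × v ≡ inj₁ a₁) ⊎ (u ≡ inj₁ a₀ × v ≡ inj₂ b₀))
    replaced-arc {inj₁ x} {inj₂ y} (edge , m') with non-edge-of-M' x y m'
    ... | inj₁ (refl , refl) = inj₂ (inj₂ (refl , refl))
    ... | inj₂ m             = inj₁ (edge , m)
    replaced-arc {inj₂ y} {inj₁ x} m' with edge-of-M' x y m'
    ... | inj₁ (refl , refl) = inj₂ (inj₁ (refl , refl))
    ... | inj₂ (m , _)       = inj₁ m

    no-forward-arc : ¬ Arc G M' (inj₁ a₁) (inj₂ b₁)
    no-forward-arc (_ , m') = contradiction (trans (sym added-edge) m') λ ()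

    replace-uncovers-A : IsMatching G M → M a₀ b₀ ≡ true → A₀ G M a₁ → A₀ G M' a₀
    replace-uncovers-A (_ , functional , _) m₀ a₁∉M y =
      ¬-not λ e → case edge-of-M' a₀ y e of λ
        { (inj₁ (refl , _))     → A₀-unmatched M a₁∉M m₀
        ; (inj₂ (m , not-a₀b₀)) → not-a₀b₀ (refl , functional a₀ y b₀ m m₀) }

    replace-uncovers-B : IsMatching G M → M a₀ b₀ ≡ true → B₀ G M b₁ → B₀ G M' b₀
    replace-uncovers-B (_ , _ , injective) m₀ b₁∉M x =
      ¬-not λ e → case edge-of-M' x b₀ e of λ
        { (inj₁ (_ , refl))     → B₀-unmatched M b₁∉M m₀
        ; (inj₂ (m , not-a₀b₀)) → not-a₀b₀ (injective x a₀ b₀ m m₀ , refl) }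

    -- With a₀ or b₀ uncovered by M', the arc a₀ → b₀ lies on no cycle, so the
    -- arcs of D(M') on cycles are arcs of D(M) or the new arc b₁ → a₁.
    arcs-on-cycles : A₀ G M' a₀ ⊎ B₀ G M' b₀
      → Reroute.ArcsOnCycles (Arc G M) (Arc G M') (inj₂ b₁) (inj₁ a₁)
    arcs-on-cycles uncovered r (w , into) (w' , out) with replaced-arc r | uncovered
    ... | inj₁ old                  | _         = inj₁ old
    ... | inj₂ (inj₁ new)           | _         = inj₂ new
    ... | inj₂ (inj₂ (refl , refl)) | inj₁ a₀∉ = ⊥-elim (A₀-no-in M' a₀∉ w into)
    ... | inj₂ (inj₂ (refl , refl)) | inj₂ b₀∉ = ⊥-elim (B₀-no-out M' b₀∉ w' out)

    replace-preserves-acyclic : IsMatching G M → Acyclic G M → A₀ G M' a₀ ⊎ B₀ G M' b₀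
      → G a₁ b₁ ≡ true → (P : Vtx p q → Set)
      → (∀ v → Star (Arc G M) (inj₁ a₁) v → Star (Arc G M) v (inj₂ b₁) → P v)
      → InducedForest G P → Acyclic G M'
    replace-preserves-acyclic matching ac uncovered a₁b₁∈G P inP forest =
      acyclic-by-rerouting (Arc G M) (Arc G M') (inj₂ b₁) (inj₁ a₁) P
        ac (arc⇒adj matching) (arcs-on-cycles uncovered) (λ ()) no-forward-arc
        inP a₁b₁∈G forest

-- Lemma 14: in case A the walks a ⇝ b' start at a ∈ A₀(M), so their vertices
-- lie in V⁺(M); in case B the walks a' ⇝ b end at b ∈ B₀(M), so they lie in V⁻(M).
lemma14 : {p q : ℕ} (G : BipGraph p q) (M M' : EdgeSet p q)
    → IsMaximumMatching G M
    → Acyclic G M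
    → InducedForest G (V⁺ G M)
    → InducedForest G (V⁻ G M)
    → EdgeExchange G M M'
    → Acyclic G M'
lemma14 G M M' (matching , _) ac forest⁺ _
        (_ , inj₁ (a , a' , b' , a∉M , a'b'∈M , ab'∈G , M'≡)) =
  replace-preserves-acyclic G M'≡ matching ac
    (inj₁ (replace-uncovers-A G M'≡ matching a'b'∈M a∉M))
    ab'∈G (V⁺ G M) (λ v a⇝v _ → a , a∉M , a⇝v) forest⁺
lemma14 G M M' (matching , _) ac _ forest⁻
        (_ , inj₂ (b , a' , b' , b∉M , a'b'∈M , a'b∈G , M'≡)) =
  replace-preserves-acyclic G M'≡ matching ac
    (inj₂ (replace-uncovers-B G M'≡ matching a'b'∈M b∉M))
    a'b∈G (V⁻ G M) (λ v _ v⇝b → b , b∉M , v⇝b) forest⁻
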